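{- The n-clause set \(S(\eta)\) consisting of the n-clauses (C1) \(\mathsf{0} \triangleright c\), (C2) \(\forall x\,\forall y\,(x \triangleright y \rightarrow \mathsf{s}(x) \triangleright \mathsf{s}(x) + y)\), and (C3) \(\forall x\,\forall y\,(\eta = x \rightarrow \neg\, x \triangleright y)\) is refuted by a cycle.
   Context: Let \(L\) be the language with two sorts \(\mathrm{nat}\) and \(\iota\), function symbols \(\mathsf{0} : \mathrm{nat}\), \(\mathsf{s} : \mathrm{nat} \to \mathrm{nat}\), \(+ : \mathrm{nat} \times \iota \to \iota\), \(c : \iota\), and a binary predicate symbol \(\triangleright : \mathrm{nat} \times \iota\) written infix. \(\eta\) is a distinguished free variable of sort \(\mathrm{nat}\), \(\overline{k} := \mathsf{s}^{k}\mathsf{0}\). An n-clause is a clause \(\forall \vec{x}\,(N(\eta,\vec{x}) \vee C(\vec{x}))\) with \(N\) a disjunction of literals \(\eta \neq t(\vec{x})\) and \(C\) not involving terms of sort \(\mathrm{nat}\) in equations; an n-clause set is a conjunction of n-clauses. For \(\mathcal{C} = \forall \vec{x}\,(\bigvee_{l=1}^{k}\eta \neq t_{l} \vee C)\), \(\mathcal{C}{\downarrow_{i}} := \forall \vec{x}\,(\bigvee_{l=1}^{k}\eta \neq \mathsf{s}^{i}(t_{l}) \vee C)\), extended conjunctively to n-clause sets. A triple \((i,j,S)\) with \(j>0\) and \(S \subseteq R\) is a cycle for an n-clause set \(R\) if \(S \vdash \eta \neq \overline{k}\) for \(k = i,\dots,i+j-1\) and \(S \vdash S{\downarrow_{j}}\);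 \(R\) is refuted by a cycle if there is a cycle \((i,j,S)\) for \(R\) with \(R \vdash \eta \neq \overline{k}\) for \(k = 0,\dots,i-1\). -}

module Defs where

open import Data.Nat using (ℕ; zero; suc; _+_; _<_; _≤_)
open import Data.List using (List; []; _∷_; map)
open import Data.List.Relation.Unary.All using (All)
open import Data.List.Relation.Binary.Subset.Propositional using (_⊆_)
open import Data.Product using (Σ; _×_; ∃-syntax)
open import Data.Empty using (⊥)
open import Relation.Nullary using (¬_)
open import Relation.Binary.PropositionalEquality using (_≡_)

data Sort : Set where
  nat ι : Sort

Ctx : Set
Ctx = List Sort

data Var : Ctx → Sort → Set where
  vz : ∀ {Γ s} → Var (s ∷ Γ) s
  vs : ∀ {Γ s t} → Var Γ s → Var (t ∷ Γ) s

-- terms over the bound variables x⃗ (η does not occur inside terms;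
-- it only occurs as the left-hand side of the literals η ≠ t of N)
data Tm (Γ : Ctx) : Sort → Set where
  var  : ∀ {s} → Var Γ s → Tm Γ s
  𝟘    : Tm Γ nat
  𝕤    : Tm Γ nat → Tm Γ nat
  _⊕_  : Tm Γ nat → Tm Γ ι → Tm Γ ι
  𝕔    : Tm Γ ι

data Lit (Γ : Ctx) : Set where
  pos▷ neg▷ : Tm Γ nat → Tm Γ ι → Lit Γ
  pos≈ neg≈ : Tm Γ ι → Tm Γ ι → Lit Γ

-- n-clause  ∀ x⃗ ( ⋁_{t ∈ N} η ≠ t(x⃗)  ∨  ⋁ C(x⃗) )
record NClause : Set where
  constructor nclause
  field
    ctx : Ctx
    N   : List (Tm ctx nat)
    C   : List (Lit ctx)

NClauseSet : Set
NClauseSet = List NClause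

num : ∀ {Γ} → ℕ → Tm Γ nat
num zero    = 𝟘
num (suc k) = 𝕤 (num k)

𝕤^ : ∀ {Γ} → ℕ → Tm Γ nat → Tm Γ nat
𝕤^ zero    t = t
𝕤^ (suc i) t = 𝕤 (𝕤^ i t)

_↓_ : NClause → ℕ → NClause
nclause Γ N C ↓ i = nclause Γ (map (𝕤^ i) N) C

_⇓_ : NClauseSet → ℕ → NClauseSet
R ⇓ i = map (_↓ i) R

η≠ : ℕ → NClause
η≠ k = nclause [] (num k ∷ []) []

record Structure : Set₁ where
  field
    |nat| |ι| : Set
    z   : |nat|
    sc  : |nat| → |nat|
    pl  : |nat| → |ι| → |ι|
    cc  : |ι|
    tri : |nat| → |ι| → Set

module _ (M : Structure) where
  open Structure M

  ⟦_⟧S : Sort → Set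
  ⟦ nat ⟧S = |nat|
  ⟦ ι ⟧S   = |ι|

  Env : Ctx → Set
  Env Γ = ∀ {s} → Var Γ s → ⟦ s ⟧S

  ⟦_⟧t : ∀ {Γ s} → Tm Γ s → Env Γ → ⟦ s ⟧S
  ⟦ var x ⟧t ρ = ρ x
  ⟦ 𝟘 ⟧t ρ     = z
  ⟦ 𝕤 t ⟧t ρ   = sc (⟦ t ⟧t ρ)
  ⟦ t ⊕ u ⟧t ρ = pl (⟦ t ⟧t ρ) (⟦ u ⟧t ρ)
  ⟦ 𝕔 ⟧t ρ     = cc

  ⟦_⟧l : ∀ {Γ} → Lit Γ → Env Γ → Set
  ⟦ pos▷ t u ⟧l ρ = tri (⟦ t ⟧t ρ) (⟦ u ⟧t ρ)
  ⟦ neg▷ t u ⟧l ρ = ¬ tri (⟦ t ⟧t ρ) (⟦ u ⟧t ρ)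
  ⟦ pos≈ t u ⟧l ρ = ⟦ t ⟧t ρ ≡ ⟦ u ⟧t ρ
  ⟦ neg≈ t u ⟧l ρ = ¬ (⟦ t ⟧t ρ ≡ ⟦ u ⟧t ρ)

  -- a clause (disjunction) holds classically: not all of its literals fail
  SatClause : |nat| → NClause → Set
  SatClause e (nclause Γ N C) =
    (ρ : Env Γ) →
    ¬ (All (λ t → ¬ ¬ (e ≡ ⟦ t ⟧t ρ)) N × All (λ l → ¬ ⟦ l ⟧l ρ) C)

  SatSet : |nat| → NClauseSet → Set
  SatSet e R = All (SatClause e) R

_⊢_ : NClauseSet → NClauseSet → Set₁
R ⊢ T = (M : Structure) (e : Structure.|nat| M) → SatSet M e R → SatSet M e T

IsCycle : NClauseSet → ℕ → ℕ → NClauseSet → Set₁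
IsCycle R i j S =
  (0 < j) × (S ⊆ R)
  × ((k : ℕ) → i ≤ k → k < i + j → S ⊢ (η≠ k ∷ []))
  × (S ⊢ (S ⇓ j))

RefutedByCycle : NClauseSet → Set₁
RefutedByCycle R =
  ∃[ i ] ∃[ j ] ∃[ S ] (IsCycle R i j S × ((k : ℕ) → k < i → R ⊢ (η≠ k ∷ [])))

private
  x : Tm (nat ∷ ι ∷ []) nat
  x = var vz
  y : Tm (nat ∷ ι ∷ []) ι
  y = var (vs vz)

C1 : NClause
C1 = nclause [] [] (pos▷ 𝟘 𝕔 ∷ [])

C2 : NClause
C2 = nclause (nat ∷ ι ∷ []) [] (neg▷ x y ∷ pos▷ (𝕤 x) (𝕤 x ⊕ y) ∷ [])

C3 : NClause
C3 = nclause (nat ∷ ι ∷ []) (x ∷ []) (neg▷ x y ∷ [])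

Sη : NClauseSet
Sη = C1 ∷ C2 ∷ C3 ∷ []

-- The cycle is (0, 1, S(η)).  Clauses (C1) and (C2) contain no η-literal, so they are
-- their own shifts; the shifted (C3), η ≠ s(x) ∨ ¬ x ▷ y, follows by applying (C2) to
-- x ▷ y and then (C3) to s(x) ▷ s(x) + y.  Finally (C3) applied to 0 ▷ c gives η ≠ 0.
module Submission where

open import Defs
open import Data.Nat using (_+_; _<_; _≤_; z≤n; s≤s)
open import Data.Nat.Properties using (≤-antisym; m<1+n⇒m≤n; +-comm)
open import Data.List using ([]; _∷_)
open import Data.List.Relation.Unary.All using ([]; _∷_)
open import Data.List.Relation.Binary.Subset.Propositional using (_⊆_)
open import Data.List.Relation.Binary.Subset.Propositional.Properties using (⊆-refl)
open import Data.Product using (_,_)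
open import Data.Empty using (⊥)
open import Relation.Nullary using (¬_)
open import Relation.Binary.PropositionalEquality using (_≡_; subst)

refutedByCycle-from-0 : ∀ {R j S} → IsCycle R 0 j S → RefutedByCycle R
refutedByCycle-from-0 cycle = 0 , _ , _ , cycle , λ _ ()

cycle-of-length-1 : ∀ {R i S} →
  S ⊆ R → S ⊢ (η≠ i ∷ []) → S ⊢ (S ⇓ 1) → IsCycle R i 1 S
cycle-of-length-1 {i = i} S⊆R S⊢η≠i S⊢S⇓1 =
  s≤s z≤n , S⊆R , only-i , S⊢S⇓1
  where
  only-i : ∀ k → i ≤ k → k < i + 1 → _ ⊢ (η≠ k ∷ [])
  only-i k i≤k k<i+1 =
    subst (λ n → _ ⊢ (η≠ n ∷ []))
          (≤-antisym i≤k (m<1+n⇒m≤n (subst (k <_) (+-comm i 1) k<i+1)))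
          S⊢η≠i

module _ (M : Structure) (e : Structure.|nat| M) where
  open Structure M

  ⟨_,_⟩ : |nat| → |ι| → Env M (nat ∷ ι ∷ [])
  ⟨ a , b ⟩ vz           = a
  ⟨ a , b ⟩ (vs vz)      = b
  ⟨ a , b ⟩ (vs (vs ()))

  empty-env : Env M []
  empty-env ()

  -- Satisfaction of a clause is classical, so the facts below hold under ¬ ¬.
  0▷c : SatClause M e C1 → ¬ ¬ tri z cc
  0▷c sat ¬0▷c = sat empty-env ([] , ¬0▷c ∷ [])

  ▷-step : SatClause M e C2 →
    ∀ {a b} → ¬ ¬ tri a b → ¬ ¬ tri (sc a) (pl (sc a) b)
  ▷-step sat {a} {b} a▷b ¬sa▷sa+b = sat ⟨ a , b ⟩ ([] , a▷b ∷ ¬sa▷sa+b ∷ [])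

  η-not-▷ : SatClause M e C3 →
    ∀ {a b} → ¬ ¬ (e ≡ a) → ¬ ¬ tri a b → ⊥
  η-not-▷ sat {a} {b} e≡a a▷b = sat ⟨ a , b ⟩ (e≡a ∷ [] , a▷b ∷ [])

Sη⊢η≠0 : Sη ⊢ (η≠ 0 ∷ [])
Sη⊢η≠0 M e (c1 ∷ _ ∷ c3 ∷ []) =
  (λ { _ (e≡0 ∷ [] , []) → η-not-▷ M e c3 e≡0 (0▷c M e c1) }) ∷ []

Sη⊢Sη⇓1 : Sη ⊢ (Sη ⇓ 1)
Sη⊢Sη⇓1 M e (c1 ∷ c2 ∷ c3 ∷ []) = c1 ∷ c2 ∷ shifted-C3 ∷ []
  where
  shifted-C3 : SatClause M e (C3 ↓ 1)
  shifted-C3 _ (e≡sa ∷ [] , a▷b ∷ []) = η-not-▷ M e c3 e≡sa (▷-step M e c2 a▷b)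

lemma5p6 : RefutedByCycle Sη
lemma5p6 = refutedByCycle-from-0 (cycle-of-length-1 ⊆-refl Sη⊢η≠0 Sη⊢Sη⇓1)
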